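{- Let $k,\ell,D\in\mathbb{N}$ and let $G=(V,E)$ be a $D$-bounded graph with a proper $k$-coloring $\chi$. Let $e_1,\dots,e_t\in E$ be such that $B_G(\ell,e_i)\cap B_G(\ell,e_j)=\emptyset$ for all $i\ne j\in[t]$, and let $\tau=(e_1,\dots,e_t)$. Then the following two distributions on $(\mathcal{T}_{k,\ell,D})^t$ are identical: (1) sample a uniformly random ordering $\sigma'$ of the multiset $E\setminus\{e_1,\dots,e_t\}$ and output the tuple whose $i$-th entry is the radius-$\ell$ visible type of $e_i$ in $(G,\chi)$ under the ordering $\tau\|\sigma'$ of $E$ (concatenation); (2) the product distribution $\mathrm{VisDist}(T_1)\times\cdots\times\mathrm{VisDist}(T_t)$, where $T_i$ is the radius-$\ell$ neighborhood type of $e_i$ in $(G,\chi)$.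
   Context: A graph is a directed multigraph $G=(V,E)$: $V$ finite, $E$ a finite multiset of ordered pairs $(u,v)$, $u\ne v$; $\mathrm{verts}((u,v))=\{u,v\}$. Degrees count incident edges with multiplicity in both directions; $D$-bounded means all degrees at most $D$. Paths ignore direction; $B_H(r,w)$ is the set of vertices joined to $w$ by a path of length at most $r$ in $H$; for $e=(u,v)$, $B_H(r,e)=B_H(r,u)\cup B_H(r,v)$. $G[U]$ is the induced subgraph. A proper $k$-coloring has $\chi(u)\ne\chi(v)$ on every edge. $E\setminus\{e_1,\dots,e_t\}$ removes one copy of each $e_i$. An ordering of a multiset of size $m$ lists each element as many times as its multiplicity. A doubly rooted $k$-colored graph is $(H,\psi,e)$, $\psi$ a proper $k$-coloring, $e$ an edge of $H$; two are isomorphic if a vertex bijection preserves edge multiplicities, colors (no permutation of colors) and the root edge; the type is the isomorphism class. $\mathcal{T}_{k,\ell,D}$ is the finite set of types of $D$-bounded doubly rooted $k$-colored graphs in which every vertex is within distance $\ell$ of an endpoint of the root edge. The radius-$\ell$ neighborhood type of $e$ in $(G,\chi)$ is the type of $(G[N],\chi|_N,e)$, $N=B_G(\ell,e)$. Visible neighborhood of $e=(u,v)$ under ordering $\sigma$ of $E$ ($|E|=m$): start with $\overline V=\{u,v\}$, $\overline E=\emptyset$; for $i=1,\dots,m$, if $\mathrm{verts}(\sigma(i))\cap B_{(\overline V,\overline E)}(\ell-1,e)\ne\emptyset$ add $\sigma(i)$ to $\overline E$ and its endpoints to $\overline V$; the radius-$\ell$ visible type is the type of $((\overline V,\overline E),\chi|_{\overline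 V},e)$. For $T\in\mathcal{T}_{k,\ell,D}$, $\mathrm{VisDist}(T)$ is the distribution of the radius-$\ell$ visible type of the root edge of any representative $(H,\psi,e)$ of $T$ under a uniformly random ordering of $H$'s edges (independent of the representative). -}

module Defs where

open import Data.Nat using (ℕ; zero; suc; _+_; _*_; _≤_)
open import Data.Bool using (Bool; true; false; _∧_; _∨_; if_then_else_; not)
open import Data.Fin using (Fin; zero; suc; _≟_)
open import Data.List using (List; []; _∷_; map; concatMap; allFin; _++_)
open import Data.Bool.ListAction using (any; all)
open import Data.List.Membership.Propositional using (_∈_)
open import Data.Vec using (Vec; lookup; toList)
open import Data.Product using (_×_; _,_; proj₁; proj₂)
open import Relation.Nullary using (¬_)
open import Relation.Nullary.Decidable using (⌊_⌋)
open import Relation.Binary.PropositionalEquality using (_≡_; _≢_)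

countBy : {A : Set} → (A → Bool) → List A → ℕ
countBy p [] = 0
countBy p (x ∷ xs) = if p x then suc (countBy p xs) else countBy p xs

prodFin : (t : ℕ) → (Fin t → ℕ) → ℕ
prodFin zero f = 1
prodFin (suc t) f = f zero * prodFin t (λ i → f (suc i))

_==_ : {n : ℕ} → Fin n → Fin n → Bool
a == b = ⌊ a ≟ b ⌋

-- Graphs: vertex set Fin n, edge multiset given as a list of ordered
-- pairs (multiplicity = number of occurrences in the list).

Edge : ℕ → Set
Edge n = Fin n × Fin n

edgeEq : {n : ℕ} → Edge n → Edge n → Bool
edgeEq (a , b) (c , d) = (a == c) ∧ (b == d)

mult : {n : ℕ} → Edge n → List (Edge n) → ℕ
mult x Es = countBy (edgeEq x) Es

deg : {n : ℕ} → Fin n → List (Edge n) → ℕ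
deg w Es = countBy (λ x → (proj₁ x == w) ∨ (proj₂ x == w)) Es

Loopless : {n : ℕ} → List (Edge n) → Set
Loopless Es = ∀ x → x ∈ Es → proj₁ x ≢ proj₂ x

DBounded : {n : ℕ} → ℕ → List (Edge n) → Set
DBounded {n} D Es = (w : Fin n) → deg w Es ≤ D

ProperColoring : {n k : ℕ} → (Fin n → Fin k) → List (Edge n) → Set
ProperColoring χ Es = ∀ x → x ∈ Es → χ (proj₁ x) ≢ χ (proj₂ x)

removeOne : {n : ℕ} → Edge n → List (Edge n) → List (Edge n)
removeOne x [] = []
removeOne x (y ∷ ys) = if edgeEq x y then ys else y ∷ removeOne x ys

removeAll : {n : ℕ} → List (Edge n) → List (Edge n) → List (Edge n)
removeAll [] Es = Es
removeAll (x ∷ xs) Es = removeOne x (removeAll xs Es)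

-- Balls. inBall r Es e w = true iff w ∈ B_H(r, e) where H has edge list Es
-- (paths ignore direction, length ≤ r, starting at an endpoint of e).

inBall : {n : ℕ} → ℕ → List (Edge n) → Edge n → Fin n → Bool
inBall zero Es (u , v) w = (w == u) ∨ (w == v)
inBall (suc r) Es e w =
  inBall r Es e w ∨
  any (λ x → ((proj₁ x == w) ∧ inBall r Es e (proj₂ x))
           ∨ ((proj₂ x == w) ∧ inBall r Es e (proj₁ x))) Es

DisjointBalls : {n t : ℕ} → ℕ → List (Edge n) → Vec (Edge n) t → Set
DisjointBalls {n} {t} ℓ Es τ =
  (i j : Fin t) → i ≢ j → (w : Fin n) →
  inBall ℓ Es (lookup τ i) w ≡ true → inBall ℓ Es (lookup τ j) w ≡ false

-- All orderings of a list (as sequences, copies distinguished by position;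
-- there are exactly m! of them, so the uniform distribution on this list
-- induces the uniform random ordering of the multiset).

insertions : {A : Set} → A → List A → List (List A)
insertions x [] = (x ∷ []) ∷ []
insertions x (y ∷ ys) = (x ∷ y ∷ ys) ∷ map (y ∷_) (insertions x ys)

perms : {A : Set} → List A → List (List A)
perms [] = [] ∷ []
perms (x ∷ xs) = concatMap (insertions x) (perms xs)

-- Doubly rooted k-colored graphs, presented on an ambient Fin N with a
-- vertex-membership predicate (so induced/visible subgraphs of G can be
-- represented directly).

record RGraph (k : ℕ) : Set where
  field
    N     : ℕ
    inV   : Fin N → Bool
    edges : List (Edge N)
    col   : Fin N → Fin k
    root  : Edge N
open RGraph public

consF : {a b : ℕ} → Fin b → (Fin a → Fin b) → Fin (suc a) → Fin b
consF x f zero = x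
consF x f (suc i) = f i

allFuns : (a b : ℕ) → List (Fin a → Fin b)
allFuns zero b = (λ ()) ∷ []
allFuns (suc a) b = concatMap (λ x → map (consF x) (allFuns a b)) (allFin b)

-- f : G₁ → G₂ with inverse g is an isomorphism of doubly rooted colored
-- graphs: bijection between vertex sets, preserving edge multiplicities,
-- colours (no colour permutation) and the root edge.
isIsoPair : {k : ℕ} (G₁ G₂ : RGraph k) →
            (Fin (N G₁) → Fin (N G₂)) → (Fin (N G₂) → Fin (N G₁)) → Bool
isIsoPair G₁ G₂ f g =
  all (λ a → not (inV G₁ a) ∨
        (inV G₂ (f a) ∧ (g (f a) == a) ∧ (col G₁ a == col G₂ (f a)) ∧
         all (λ b → not (inV G₁ b) ∨
               ⌊ Data.Nat._≟_ (mult (a , b) (edges G₁))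
                              (mult (f a , f b) (edges G₂)) ⌋)
             (allFin (N G₁))))
      (allFin (N G₁))
  ∧ all (λ c → not (inV G₂ c) ∨ (inV G₁ (g c) ∧ (f (g c) == c)))
        (allFin (N G₂))
  ∧ (f (proj₁ (root G₁)) == proj₁ (root G₂))
  ∧ (f (proj₂ (root G₁)) == proj₂ (root G₂))

sameType : {k : ℕ} → RGraph k → RGraph k → Bool
sameType G₁ G₂ =
  any (λ f → any (λ g → isIsoPair G₁ G₂ f g) (allFuns (N G₂) (N G₁)))
      (allFuns (N G₁) (N G₂))

-- does edge x touch B_{(V̄,Ē)}(ℓ-1, e)?  (for ℓ = 0 the ball of radius -1
-- is empty)
touches : {n : ℕ} → ℕ → Edge n → List (Edge n) → Edge n → Bool
touches zero e Ebar x = false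
touches (suc r) e Ebar x = inBall r Ebar e (proj₁ x) ∨ inBall r Ebar e (proj₂ x)

visEdgesGo : {n : ℕ} → ℕ → Edge n → List (Edge n) → List (Edge n) → List (Edge n)
visEdgesGo ℓ e acc [] = acc
visEdgesGo ℓ e acc (x ∷ σ) =
  visEdgesGo ℓ e (if touches ℓ e acc x then x ∷ acc else acc) σ

visEdges : {n : ℕ} → ℕ → Edge n → List (Edge n) → List (Edge n)
visEdges ℓ e σ = visEdgesGo ℓ e [] σ

visVerts : {n : ℕ} → Edge n → List (Edge n) → Fin n → Bool
visVerts (u , v) Ebar w =
  (w == u) ∨ (w == v) ∨ any (λ x → (proj₁ x == w) ∨ (proj₂ x == w)) Ebar

visGraph : {n k : ℕ} → (Fin n → Fin k) → ℕ → Edge n → List (Edge n) → RGraph k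
visGraph {n} χ ℓ e σ = record
  { N = n ; inV = visVerts e (visEdges ℓ e σ) ; edges = visEdges ℓ e σ
  ; col = χ ; root = e }

nbhdEdges : {n : ℕ} → ℕ → List (Edge n) → Edge n → List (Edge n)
nbhdEdges ℓ Es e =
  Data.List.filterᵇ (λ x → inBall ℓ Es e (proj₁ x) ∧ inBall ℓ Es e (proj₂ x)) Es

-- Distribution (1): number of orderings σ' of E∖{e₁..e_t} for which, for
-- every i, the visible type of eᵢ under τ‖σ' equals the type of R i.
count₁ : {n k t : ℕ} → (Fin n → Fin k) → ℕ → List (Edge n) → Vec (Edge n) t →
         (Fin t → RGraph k) → ℕ
count₁ {t = t} χ ℓ Es τ R =
  countBy (λ σ' → all (λ i → sameType (visGraph χ ℓ (lookup τ i) (toList τ ++ σ')) (R i))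
                      (allFin t))
          (perms (removeAll (toList τ) Es))

total₁ : {n t : ℕ} → List (Edge n) → Vec (Edge n) t → ℕ
total₁ Es τ = Data.List.length (perms (removeAll (toList τ) Es))

-- VisDist(Tᵢ), computed on the representative (G[B_G(ℓ,eᵢ)], χ|, eᵢ):
-- number of orderings π of its edges with visible type equal to type of R',
-- out of total₂ orderings.  (Visible process on G[N] only uses its edges;
-- the ambient vertex set Fin n is irrelevant since V̄ ⊆ endpoints.)
count₂ : {n k : ℕ} → (Fin n → Fin k) → ℕ → List (Edge n) → Edge n → RGraph k → ℕ
count₂ χ ℓ Es e R' =
  countBy (λ π → sameType (visGraph χ ℓ e π) R') (perms (nbhdEdges ℓ Es e))

total₂ : {n : ℕ} → ℕ → List (Edge n) → Edge n → ℕ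
total₂ ℓ Es e = Data.List.length (perms (nbhdEdges ℓ Es e))

module Submission where

-- The visible neighbourhood of eᵢ can only reveal edges with both endpoints in B_G(ℓ, eᵢ); eᵢ comes
-- first in τ ‖ σ′, and the other roots lie outside that ball. Hence the visible type of eᵢ depends only
-- on the order in which σ′ lists the set Mᵢ of the remaining edges of G[B_G(ℓ, eᵢ)]. The position of a
-- root edge in an ordering does not affect its own visible neighbourhood, so VisDist(Tᵢ) is also the
-- distribution of that type for eᵢ followed by a uniform ordering of Mᵢ. Disjointness of the balls
-- makes the Mᵢ disjoint sublists of E ∖ τ, and the restrictions of a uniform ordering to disjoint
-- sublists are independent and uniform: an ordering of a list is a shuffle of an ordering of a
-- sublist with one of its complement, and the number of such shuffles depends only on the lengths.

open import Defs
open import Data.Bool using (Bool; true; false; T; not; _∧_; _∨_; if_then_else_)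
open import Data.Bool.ListAction using (and; or; all; any)
open import Data.Bool.Properties using (T-∧; T-∨; T-≡)
open import Data.Empty using (⊥-elim)
open import Data.Unit using (tt)
import Data.Nat as ℕ
open import Data.Nat using (ℕ; zero; suc; _+_; _*_)
open import Data.Nat.Properties
  using (+-assoc; +-comm; *-assoc; +-identityʳ; *-identityʳ; *-zeroʳ; *-distribˡ-+; *-distribʳ-+)
open import Data.Nat.Tactic.RingSolver using (solve-∀)
open import Data.Fin as Fin using (Fin; zero; suc)
open import Data.Fin.Properties using (suc-injective)
open import Data.List using (List; []; _∷_; _++_; map; concatMap; length; filter; tabulate; allFin)
open import Data.List.Properties
  using (map-cong; length-map; length-++; filter-++; filter-all; filter-none; filter-accept; filter-reject)
open import Data.List.Membership.Propositional using (_∈_; find)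
open import Data.List.Membership.Propositional.Properties using (∈-++⁻; ∈-++⁺ʳ; ∈-map⁻; ∈-concatMap⁻; ∈-tabulate⁻)
open import Data.List.Relation.Binary.Subset.Propositional using (_⊆_)
open import Data.List.Relation.Binary.Subset.Propositional.Properties using (xs⊆x∷xs; ∈-∷⁺ʳ)
open import Data.List.Relation.Unary.All as All using (All; []; _∷_)
open import Data.List.Relation.Unary.All.Properties using (all-filter; tabulate⁺; All¬⇒¬Any)
open import Data.List.Relation.Unary.Unique.Propositional using (Unique)
import Data.List.Relation.Unary.Unique.Propositional.Properties as Unique
open import Data.List.Relation.Unary.AllPairs using (_∷_)
open import Data.List.Relation.Unary.Any as Any using (here; there)
open import Data.List.Relation.Unary.Any.Properties using (any⁺; any⁻)
open import Data.List.Relation.Binary.Permutation.Propositional as ↭ using (_↭_; prep; swap)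
open import Data.List.Relation.Binary.Permutation.Propositional.Properties
  using (↭-length; ∈-resp-↭; All-resp-↭; Any-resp-↭; ++⁺ˡ; shift; filter-↭)
open import Data.Product using (_×_; _,_; proj₁; proj₂; ∃-syntax)
open import Data.Sum using (_⊎_; inj₁; inj₂; [_,_]′)
open import Data.Vec using (Vec; []; _∷_; lookup; toList)
open import Function using (_∘_)
open import Relation.Binary.PropositionalEquality
  using (_≡_; _≢_; refl; sym; trans; cong; cong₂; subst; subst₂; module ≡-Reasoning)
open import Relation.Unary using (Pred; Decidable; ∁)
open import Relation.Nullary using (¬_; does; yes; no)
open import Relation.Nullary.Decidable using (⌊_⌋; T?; toWitness; fromWitness)
open import Function.Bundles using (Equivalence)
open import Level using (0ℓ)
open import Relation.Unary.Properties using (∁?)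

private variable
  A B : Set

∑ : List A → (A → ℕ) → ℕ
∑ [] F = 0
∑ (x ∷ xs) F = F x + ∑ xs F

module _ {F : A → ℕ} where

  ∑-++ : (xs ys : List A) → ∑ (xs ++ ys) F ≡ ∑ xs F + ∑ ys F
  ∑-++ [] ys = refl
  ∑-++ (x ∷ xs) ys = trans (cong (F x +_) (∑-++ xs ys)) (sym (+-assoc (F x) _ _))

  ∑-cong : (xs : List A) {G : A → ℕ} → (∀ {x} → x ∈ xs → F x ≡ G x) → ∑ xs F ≡ ∑ xs G
  ∑-cong [] h = refl
  ∑-cong (x ∷ xs) h = cong₂ _+_ (h (here refl)) (∑-cong xs (h ∘ there))

  ∑-const : (xs : List A) (c : ℕ) → (∀ {x} → x ∈ xs → F x ≡ c) → ∑ xs F ≡ length xs * c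
  ∑-const [] c h = refl
  ∑-const (x ∷ xs) c h = cong₂ _+_ (h (here refl)) (∑-const xs c (h ∘ there))

  ∑-*ˡ : (c : ℕ) (xs : List A) → ∑ xs (λ x → c * F x) ≡ c * ∑ xs F
  ∑-*ˡ c [] = sym (*-zeroʳ c)
  ∑-*ˡ c (x ∷ xs) = trans (cong (c * F x +_) (∑-*ˡ c xs)) (sym (*-distribˡ-+ c (F x) _))

  ∑-*ʳ : (c : ℕ) (xs : List A) → ∑ xs (λ x → F x * c) ≡ ∑ xs F * c
  ∑-*ʳ c [] = refl
  ∑-*ʳ c (x ∷ xs) = trans (cong (F x * c +_) (∑-*ʳ c xs)) (sym (*-distribʳ-+ c (F x) _))

  ∑-resp-↭ : {xs ys : List A} → xs ↭ ys → ∑ xs F ≡ ∑ ys F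
  ∑-resp-↭ ↭.refl = refl
  ∑-resp-↭ (prep x p) = cong (F x +_) (∑-resp-↭ p)
  ∑-resp-↭ (swap x y p) = trans (+-swap (F x) (F y) _) (cong (λ s → F y + (F x + s)) (∑-resp-↭ p))
    where
    +-swap : ∀ a b c → a + (b + c) ≡ b + (a + c)
    +-swap = solve-∀
  ∑-resp-↭ (↭.trans p q) = trans (∑-resp-↭ p) (∑-resp-↭ q)

∑-map : (g : A → B) (xs : List A) (F : B → ℕ) → ∑ (map g xs) F ≡ ∑ xs (F ∘ g)
∑-map g [] F = refl
∑-map g (x ∷ xs) F = cong (F (g x) +_) (∑-map g xs F)

∑-concatMap : (f : A → List B) (xs : List A) (F : B → ℕ) →
              ∑ (concatMap f xs) F ≡ ∑ xs (λ x → ∑ (f x) F)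
∑-concatMap f [] F = refl
∑-concatMap f (x ∷ xs) F = trans (∑-++ (f x) _) (cong (∑ (f x) F +_) (∑-concatMap f xs F))

∑-1 : (xs : List A) → ∑ xs (λ _ → 1) ≡ length xs
∑-1 xs = trans (∑-const xs 1 (λ _ → refl)) (*-identityʳ (length xs))

∑-+ : (xs : List A) (F G : A → ℕ) → ∑ xs (λ x → F x + G x) ≡ ∑ xs F + ∑ xs G
∑-+ [] F G = refl
∑-+ (x ∷ xs) F G = trans (cong (F x + G x +_) (∑-+ xs F G)) (+-interchange (F x) (G x) _ _)
  where
  +-interchange : ∀ a b c d → a + b + (c + d) ≡ a + c + (b + d)
  +-interchange = solve-∀

∑-comm : (xs : List A) (ys : List B) (G : A → B → ℕ) →
         ∑ xs (λ a → ∑ ys (G a)) ≡ ∑ ys (λ b → ∑ xs (λ a → G a b))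
∑-comm [] ys G = sym (trans (∑-const ys 0 (λ _ → refl)) (*-zeroʳ (length ys)))
∑-comm (x ∷ xs) ys G = trans (cong (∑ ys (G x) +_) (∑-comm xs ys G)) (sym (∑-+ ys (G x) _))

T-extensional : {a b : Bool} → (T a → T b) → (T b → T a) → a ≡ b
T-extensional {false} {false} _ _ = refl
T-extensional {false} {true} _ b⇒a = ⊥-elim (b⇒a tt)
T-extensional {true} {false} a⇒b _ = ⊥-elim (a⇒b tt)
T-extensional {true} {true} _ _ = refl

𝟙 : Bool → ℕ
𝟙 b = if b then 1 else 0

𝟙-∧ : (a b : Bool) → 𝟙 (a ∧ b) ≡ 𝟙 a * 𝟙 b
𝟙-∧ true b = sym (+-identityʳ (𝟙 b))
𝟙-∧ false b = refl

countBy-∑ : (p : A → Bool) (xs : List A) → countBy p xs ≡ ∑ xs (𝟙 ∘ p)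
countBy-∑ p [] = refl
countBy-∑ p (x ∷ xs) with p x
... | true = cong suc (countBy-∑ p xs)
... | false = countBy-∑ p xs

countBy-resp-↭ : (p : A → Bool) {xs ys : List A} → xs ↭ ys → countBy p xs ≡ countBy p ys
countBy-resp-↭ p {xs} {ys} q = trans (countBy-∑ p xs) (trans (∑-resp-↭ q) (sym (countBy-∑ p ys)))

any-resp-↭ : (p : A → Bool) {xs ys : List A} → xs ↭ ys → any p xs ≡ any p ys
any-resp-↭ p {xs} {ys} q =
  T-extensional (any⁺ p ∘ Any-resp-↭ q ∘ any⁻ p xs) (any⁺ p ∘ Any-resp-↭ (↭.↭-sym q) ∘ any⁻ p ys)

prodFin-cong : (t : ℕ) {f g : Fin t → ℕ} → (∀ i → f i ≡ g i) → prodFin t f ≡ prodFin t g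
prodFin-cong zero f≗g = refl
prodFin-cong (suc t) f≗g = cong₂ _*_ (f≗g zero) (prodFin-cong t (f≗g ∘ suc))

prodFin-* : (t : ℕ) (f g : Fin t → ℕ) → prodFin t (λ i → f i * g i) ≡ prodFin t f * prodFin t g
prodFin-* zero f g = refl
prodFin-* (suc t) f g =
  trans (cong (f zero * g zero *_) (prodFin-* t (f ∘ suc) (g ∘ suc))) (interchange (f zero) (g zero) _ _)
  where
  interchange : ∀ a b c d → a * b * (c * d) ≡ a * c * (b * d)
  interchange = solve-∀

𝟙-all-tabulate : (t : ℕ) (f : A → Bool) (g : Fin t → A) → 𝟙 (all f (tabulate g)) ≡ prodFin t (𝟙 ∘ f ∘ g)
𝟙-all-tabulate zero f g = refl
𝟙-all-tabulate (suc t) f g =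
  trans (𝟙-∧ (f (g zero)) _) (cong (𝟙 (f (g zero)) *_) (𝟙-all-tabulate t f (g ∘ suc)))

filter-∷-cong : {P : Pred A 0ℓ} (P? : Decidable P) (b : A) {xs ys : List A} →
                filter P? xs ≡ filter P? ys → filter P? (b ∷ xs) ≡ filter P? (b ∷ ys)
filter-∷-cong P? b eq with does (P? b)
... | true = cong (b ∷_) eq
... | false = eq

filter-filter-∁ : {P Q : Pred A 0ℓ} (P? : Decidable P) (Q? : Decidable Q) → (∀ {x} → P x → ¬ Q x) →
                  (xs : List A) → filter P? (filter (∁? Q?) xs) ≡ filter P? xs
filter-filter-∁ P? Q? P⇒¬Q [] = refl
filter-filter-∁ P? Q? P⇒¬Q (x ∷ xs) with Q? x
... | yes Qx = trans (filter-filter-∁ P? Q? P⇒¬Q xs) (sym (filter-reject P? (λ Px → P⇒¬Q Px Qx)))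
... | no _ = filter-∷-cong P? x (filter-filter-∁ P? Q? P⇒¬Q xs)

toList-tabulate : {t : ℕ} (τ : Vec A t) → toList τ ≡ tabulate (lookup τ)
toList-tabulate [] = refl
toList-tabulate (x ∷ τ) = cong (x ∷_) (toList-tabulate τ)

filter-tabulate-single : {P : Pred A 0ℓ} (P? : Decidable P) {t : ℕ} (f : Fin t → A) (i : Fin t) →
                         P (f i) → (∀ j → j ≢ i → ¬ P (f j)) → filter P? (tabulate f) ≡ f i ∷ []
filter-tabulate-single P? f zero Pfi ¬Pfj =
  trans (filter-accept P? Pfi) (cong (f zero ∷_) (filter-none P? (tabulate⁺ (λ j → ¬Pfj (suc j) (λ ())))))
filter-tabulate-single P? f (suc i) Pfi ¬Pfj =
  trans (filter-reject P? (¬Pfj zero (λ ())))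
        (filter-tabulate-single P? (f ∘ suc) i Pfi (λ j j≢i → ¬Pfj (suc j) (j≢i ∘ suc-injective)))

-- Orderings, insertions and shuffles

length-insertions : (x : A) (σ : List A) → length (insertions x σ) ≡ suc (length σ)
length-insertions x [] = refl
length-insertions x (y ∷ σ) = cong suc (trans (length-map (y ∷_) (insertions x σ)) (length-insertions x σ))

insertions-↭ : {x : A} (σ : List A) {π : List A} → π ∈ insertions x σ → π ↭ x ∷ σ
insertions-↭ [] (here refl) = ↭.refl
insertions-↭ (y ∷ σ) (here refl) = ↭.refl
insertions-↭ {x = x} (y ∷ σ) (there π∈) with ∈-map⁻ (y ∷_) π∈
... | π′ , π′∈ , refl = ↭.trans (prep y (insertions-↭ σ π′∈)) (swap y x ↭.refl)

∑-insertions-∷ : (x a : A) (σ : List A) (F : List A → ℕ) →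
                 ∑ (insertions x (a ∷ σ)) F ≡ F (x ∷ a ∷ σ) + ∑ (insertions x σ) (F ∘ (a ∷_))
∑-insertions-∷ x a σ F = cong (F (x ∷ a ∷ σ) +_) (∑-map (a ∷_) (insertions x σ) F)

shuffles : List A → List A → List (List A)
shuffles [] β = β ∷ []
shuffles (a ∷ α) [] = (a ∷ α) ∷ []
shuffles (a ∷ α) (b ∷ β) = map (a ∷_) (shuffles α (b ∷ β)) ++ map (b ∷_) (shuffles (a ∷ α) β)

shuffles-[]ʳ : (α : List A) → shuffles α [] ≡ α ∷ []
shuffles-[]ʳ [] = refl
shuffles-[]ʳ (a ∷ α) = refl

shuffles-[-]ˡ : (x : A) (β : List A) → shuffles (x ∷ []) β ≡ insertions x β
shuffles-[-]ˡ x [] = refl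
shuffles-[-]ˡ x (b ∷ β) = cong (λ πs → (x ∷ b ∷ β) ∷ map (b ∷_) πs) (shuffles-[-]ˡ x β)

∑-shuffles-∷∷ : (a b : A) (α β : List A) (F : List A → ℕ) →
                ∑ (shuffles (a ∷ α) (b ∷ β)) F
                ≡ ∑ (shuffles α (b ∷ β)) (F ∘ (a ∷_)) + ∑ (shuffles (a ∷ α) β) (F ∘ (b ∷_))
∑-shuffles-∷∷ a b α β F =
  trans (∑-++ (map (a ∷_) (shuffles α (b ∷ β))) _)
        (cong₂ _+_ (∑-map _ (shuffles α (b ∷ β)) F) (∑-map _ (shuffles (a ∷ α) β) F))

∑-shuffles-comm : (α β : List A) (F : List A → ℕ) → ∑ (shuffles α β) F ≡ ∑ (shuffles β α) F
∑-shuffles-comm [] [] F = refl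
∑-shuffles-comm [] (b ∷ β) F = refl
∑-shuffles-comm (a ∷ α) [] F = refl
∑-shuffles-comm (a ∷ α) (b ∷ β) F = begin
  ∑ (shuffles (a ∷ α) (b ∷ β)) F
    ≡⟨ ∑-shuffles-∷∷ a b α β F ⟩
  ∑ (shuffles α (b ∷ β)) (F ∘ (a ∷_)) + ∑ (shuffles (a ∷ α) β) (F ∘ (b ∷_))
    ≡⟨ cong₂ _+_ (∑-shuffles-comm α (b ∷ β) _) (∑-shuffles-comm (a ∷ α) β _) ⟩
  ∑ (shuffles (b ∷ β) α) (F ∘ (a ∷_)) + ∑ (shuffles β (a ∷ α)) (F ∘ (b ∷_))
    ≡⟨ +-comm (∑ (shuffles (b ∷ β) α) (F ∘ (a ∷_))) _ ⟩
  ∑ (shuffles β (a ∷ α)) (F ∘ (b ∷_)) + ∑ (shuffles (b ∷ β) α) (F ∘ (a ∷_))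
    ≡⟨ ∑-shuffles-∷∷ b a β α F ⟨
  ∑ (shuffles (b ∷ β) (a ∷ α)) F ∎
  where open ≡-Reasoning

-- Both sides enumerate the interleavings of α, β and the single element x.
∑-shuffles-insertionsˡ : (x : A) (α β : List A) (F : List A → ℕ) →
                        ∑ (shuffles α β) (λ σ → ∑ (insertions x σ) F)
                        ≡ ∑ (insertions x α) (λ α′ → ∑ (shuffles α′ β) F)
∑-shuffles-insertionsˡ x [] β F = cong (λ πs → ∑ πs F + 0) (sym (shuffles-[-]ˡ x β))
∑-shuffles-insertionsˡ x (a ∷ α) [] F =
  trans (+-identityʳ _) (∑-cong (insertions x (a ∷ α)) (λ {α′} _ →
    sym (trans (cong (λ πs → ∑ πs F) (shuffles-[]ʳ α′)) (+-identityʳ (F α′)))))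
∑-shuffles-insertionsˡ x (a ∷ α) (b ∷ β) F = begin
  ∑ (shuffles (a ∷ α) (b ∷ β)) G
    ≡⟨ ∑-shuffles-∷∷ a b α β G ⟩
  ∑ (shuffles α (b ∷ β)) (G ∘ (a ∷_)) + ∑ (shuffles (a ∷ α) β) (G ∘ (b ∷_))
    ≡⟨ cong₂ _+_ (insert-after a α (b ∷ β)) (insert-after b (a ∷ α) β) ⟩
  (A₁ + ∑ (shuffles α (b ∷ β)) (λ σ → ∑ (insertions x σ) (F ∘ (a ∷_))))
    + (B₁ + ∑ (shuffles (a ∷ α) β) (λ σ → ∑ (insertions x σ) (F ∘ (b ∷_))))
    ≡⟨ cong₂ _+_ (cong (A₁ +_) (∑-shuffles-insertionsˡ x α (b ∷ β) (F ∘ (a ∷_))))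
                 (cong (B₁ +_) (trans (∑-shuffles-insertionsˡ x (a ∷ α) β (F ∘ (b ∷_)))
                                      (cong (Z +_) (∑-map (a ∷_) (insertions x α) _)))) ⟩
  (A₁ + X) + (B₁ + (Z + Y))
    ≡⟨ regroup A₁ X B₁ Z Y ⟩
  ((A₁ + B₁) + Z) + (X + Y)
    ≡⟨ cong₂ _+_ (cong (_+ Z) (sym (∑-shuffles-∷∷ a b α β (F ∘ (x ∷_)))))
                 (trans (sym (∑-+ (insertions x α) _ _))
                        (sym (∑-cong (insertions x α) (λ {α′} _ → ∑-shuffles-∷∷ a b α′ β F)))) ⟩
  ∑ (shuffles (a ∷ α) (b ∷ β)) (F ∘ (x ∷_)) + Z + ∑ (insertions x α) (λ α′ → ∑ (shuffles (a ∷ α′) (b ∷ β)) F)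
    ≡⟨ cong₂ _+_ (sym (∑-shuffles-∷∷ x b (a ∷ α) β F)) (sym (∑-map (a ∷_) (insertions x α) _)) ⟩
  ∑ (insertions x (a ∷ α)) (λ α′ → ∑ (shuffles α′ (b ∷ β)) F) ∎
  where
  open ≡-Reasoning
  G : List _ → ℕ
  G σ = ∑ (insertions x σ) F
  insert-after : ∀ c γ δ → ∑ (shuffles γ δ) (G ∘ (c ∷_))
                 ≡ ∑ (shuffles γ δ) (λ σ → F (x ∷ c ∷ σ))
                   + ∑ (shuffles γ δ) (λ σ → ∑ (insertions x σ) (F ∘ (c ∷_)))
  insert-after c γ δ =
    trans (∑-cong (shuffles γ δ) (λ {σ} _ → ∑-insertions-∷ x c σ F)) (∑-+ (shuffles γ δ) _ _)
  A₁ = ∑ (shuffles α (b ∷ β)) (λ σ → F (x ∷ a ∷ σ))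
  B₁ = ∑ (shuffles (a ∷ α) β) (λ σ → F (x ∷ b ∷ σ))
  X = ∑ (insertions x α) (λ α′ → ∑ (shuffles α′ (b ∷ β)) (F ∘ (a ∷_)))
  Y = ∑ (insertions x α) (λ α′ → ∑ (shuffles (a ∷ α′) β) (F ∘ (b ∷_)))
  Z = ∑ (shuffles (x ∷ a ∷ α) β) (F ∘ (b ∷_))
  regroup : ∀ a₁ x′ b₁ z y → (a₁ + x′) + (b₁ + (z + y)) ≡ ((a₁ + b₁) + z) + (x′ + y)
  regroup = solve-∀

∑-shuffles-insertionsʳ : (x : A) (α β : List A) (F : List A → ℕ) →
                        ∑ (shuffles α β) (λ σ → ∑ (insertions x σ) F)
                        ≡ ∑ (insertions x β) (λ β′ → ∑ (shuffles α β′) F)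
∑-shuffles-insertionsʳ x α β F =
  trans (∑-shuffles-comm α β _)
        (trans (∑-shuffles-insertionsˡ x β α F) (∑-cong (insertions x β) (λ {β′} _ → ∑-shuffles-comm β′ α F)))

∑-insertions-comm : (x y : A) (σ : List A) (F : List A → ℕ) →
                    ∑ (insertions y σ) (λ π → ∑ (insertions x π) F)
                    ≡ ∑ (insertions x σ) (λ π → ∑ (insertions y π) F)
∑-insertions-comm x y σ F = begin
  ∑ (insertions y σ) (λ π → ∑ (insertions x π) F)
    ≡⟨ cong (λ πs → ∑ πs (λ π → ∑ (insertions x π) F)) (shuffles-[-]ˡ y σ) ⟨
  ∑ (shuffles (y ∷ []) σ) (λ π → ∑ (insertions x π) F)
    ≡⟨ ∑-shuffles-insertionsˡ x (y ∷ []) σ F ⟩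
  ∑ (shuffles (x ∷ y ∷ []) σ) F + (∑ (shuffles (y ∷ x ∷ []) σ) F + 0)
    ≡⟨ swap-summands (∑ (shuffles (x ∷ y ∷ []) σ) F) _ ⟩
  ∑ (shuffles (y ∷ x ∷ []) σ) F + (∑ (shuffles (x ∷ y ∷ []) σ) F + 0)
    ≡⟨ ∑-shuffles-insertionsˡ y (x ∷ []) σ F ⟨
  ∑ (shuffles (x ∷ []) σ) (λ π → ∑ (insertions y π) F)
    ≡⟨ cong (λ πs → ∑ πs (λ π → ∑ (insertions y π) F)) (shuffles-[-]ˡ x σ) ⟩
  ∑ (insertions x σ) (λ π → ∑ (insertions y π) F) ∎
  where
  open ≡-Reasoning
  swap-summands : ∀ m n → m + (n + 0) ≡ n + (m + 0)
  swap-summands = solve-∀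

shuffleCount : ℕ → ℕ → ℕ
shuffleCount zero n = 1
shuffleCount (suc m) zero = 1
shuffleCount (suc m) (suc n) = shuffleCount m (suc n) + shuffleCount (suc m) n

length-shuffles : (α β : List A) → length (shuffles α β) ≡ shuffleCount (length α) (length β)
length-shuffles [] β = refl
length-shuffles (a ∷ α) [] = refl
length-shuffles (a ∷ α) (b ∷ β) =
  trans (length-++ (map (a ∷_) (shuffles α (b ∷ β))))
        (cong₂ _+_ (trans (length-map _ (shuffles α (b ∷ β))) (length-shuffles α (b ∷ β)))
                   (trans (length-map _ (shuffles (a ∷ α) β)) (length-shuffles (a ∷ α) β)))

perms-↭ : {L σ : List A} → σ ∈ perms L → σ ↭ L
perms-↭ {L = []} (here refl) = ↭.refl
perms-↭ {L = x ∷ L} σ∈ with find (∈-concatMap⁻ (insertions x) σ∈)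
... | γ , γ∈ , σ∈γ = ↭.trans (insertions-↭ γ σ∈γ) (prep x (perms-↭ {L = L} γ∈))

∑-perms-∷ : (x : A) (L : List A) (F : List A → ℕ) →
            ∑ (perms (x ∷ L)) F ≡ ∑ (perms L) (λ σ → ∑ (insertions x σ) F)
∑-perms-∷ x L = ∑-concatMap (insertions x) (perms L)

∑-perms-resp-↭ : {L L′ : List A} → L ↭ L′ → (F : List A → ℕ) → ∑ (perms L) F ≡ ∑ (perms L′) F
∑-perms-resp-↭ ↭.refl F = refl
∑-perms-resp-↭ {L = x ∷ L} {L′ = .x ∷ L′} (prep x p) F =
  trans (∑-perms-∷ x L F) (trans (∑-perms-resp-↭ p _) (sym (∑-perms-∷ x L′ F)))
∑-perms-resp-↭ {L = x ∷ y ∷ L} {L′ = .y ∷ .x ∷ L′} (swap .x .y p) F = begin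
  ∑ (perms (x ∷ y ∷ L)) F
    ≡⟨ trans (∑-perms-∷ x (y ∷ L) F) (∑-perms-∷ y L _) ⟩
  ∑ (perms L) (λ σ → ∑ (insertions y σ) (λ π → ∑ (insertions x π) F))
    ≡⟨ ∑-cong (perms L) (λ {σ} _ → ∑-insertions-comm x y σ F) ⟩
  ∑ (perms L) (λ σ → ∑ (insertions x σ) (λ π → ∑ (insertions y π) F))
    ≡⟨ ∑-perms-resp-↭ p _ ⟩
  ∑ (perms L′) (λ σ → ∑ (insertions x σ) (λ π → ∑ (insertions y π) F))
    ≡⟨ trans (∑-perms-∷ y (x ∷ L′) F) (∑-perms-∷ x L′ _) ⟨
  ∑ (perms (y ∷ x ∷ L′)) F ∎
  where open ≡-Reasoning
∑-perms-resp-↭ (↭.trans p q) F = trans (∑-perms-resp-↭ p F) (∑-perms-resp-↭ q F)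

∑-perms-insertions-invariant : {x : A} {M N : List A} → N ↭ x ∷ M → (F h : List A → ℕ) →
                               (∀ γ {π} → π ∈ insertions x γ → F π ≡ h γ) →
                               ∑ (perms N) F ≡ suc (length M) * ∑ (perms M) h
∑-perms-insertions-invariant {x = x} {M} {N} N↭ F h F≡h = begin
  ∑ (perms N) F                            ≡⟨ ∑-perms-resp-↭ N↭ F ⟩
  ∑ (perms (x ∷ M)) F                      ≡⟨ ∑-perms-∷ x M F ⟩
  ∑ (perms M) (λ γ → ∑ (insertions x γ) F) ≡⟨ ∑-cong (perms M) ∑-insertions ⟩
  ∑ (perms M) (λ γ → suc (length M) * h γ) ≡⟨ ∑-*ˡ (suc (length M)) (perms M) ⟩
  suc (length M) * ∑ (perms M) h           ∎
  where
  open ≡-Reasoning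
  ∑-insertions : ∀ {γ} → γ ∈ perms M → ∑ (insertions x γ) F ≡ suc (length M) * h γ
  ∑-insertions {γ} γ∈ =
    trans (∑-const (insertions x γ) (h γ) (F≡h γ))
          (cong (_* h γ) (trans (length-insertions x γ) (cong suc (↭-length (perms-↭ {L = M} γ∈)))))

module _ {P : Pred A 0ℓ} (P? : Decidable P) where

  filter-shuffles-rejectˡ : (α β : List A) {σ : List A} → All (∁ P) α → σ ∈ shuffles α β →
                            filter P? σ ≡ filter P? β
  filter-shuffles-rejectˡ [] β _ (here refl) = refl
  filter-shuffles-rejectˡ (a ∷ α) [] (¬Pa ∷ ¬Pα) (here refl) =
    trans (filter-reject P? ¬Pa) (filter-none P? ¬Pα)
  filter-shuffles-rejectˡ (a ∷ α) (b ∷ β) (¬Pa ∷ ¬Pα) σ∈ with ∈-++⁻ (map (a ∷_) (shuffles α (b ∷ β))) σ∈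
  ... | inj₁ σ∈ˡ with ∈-map⁻ (a ∷_) σ∈ˡ
  ...   | σ′ , σ′∈ , refl = trans (filter-reject P? ¬Pa) (filter-shuffles-rejectˡ α (b ∷ β) ¬Pα σ′∈)
  filter-shuffles-rejectˡ (a ∷ α) (b ∷ β) ¬Pα′ _ | inj₂ σ∈ʳ with ∈-map⁻ (b ∷_) σ∈ʳ
  ...   | σ′ , σ′∈ , refl = filter-∷-cong P? b (filter-shuffles-rejectˡ (a ∷ α) β ¬Pα′ σ′∈)

  filter-shuffles-rejectʳ : (α β : List A) {σ : List A} → All (∁ P) β → σ ∈ shuffles α β →
                            filter P? σ ≡ filter P? α
  filter-shuffles-rejectʳ [] β ¬Pβ (here refl) = filter-none P? ¬Pβ
  filter-shuffles-rejectʳ (a ∷ α) [] _ (here refl) = refl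
  filter-shuffles-rejectʳ (a ∷ α) (b ∷ β) (¬Pb ∷ ¬Pβ) σ∈ with ∈-++⁻ (map (a ∷_) (shuffles α (b ∷ β))) σ∈
  ... | inj₁ σ∈ˡ with ∈-map⁻ (a ∷_) σ∈ˡ
  ...   | σ′ , σ′∈ , refl = filter-∷-cong P? a (filter-shuffles-rejectʳ α (b ∷ β) (¬Pb ∷ ¬Pβ) σ′∈)
  filter-shuffles-rejectʳ (a ∷ α) (b ∷ β) (¬Pb ∷ ¬Pβ) _ | inj₂ σ∈ʳ with ∈-map⁻ (b ∷_) σ∈ʳ
  ...   | σ′ , σ′∈ , refl = trans (filter-reject P? ¬Pb) (filter-shuffles-rejectʳ (a ∷ α) β ¬Pβ σ′∈)

module _ {P : Pred A 0ℓ} (P? : Decidable P) where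

  ∑-perms-shuffles : (L : List A) (F : List A → ℕ) →
                     ∑ (perms L) F
                     ≡ ∑ (perms (filter P? L)) (λ α → ∑ (perms (filter (∁? P?) L)) (λ β → ∑ (shuffles α β) F))
  ∑-perms-shuffles [] F = cong (_+ 0) (sym (trans (+-identityʳ _) (+-identityʳ _)))
  ∑-perms-shuffles (x ∷ L) F with P? x
  ... | yes _ = begin
    ∑ (perms (x ∷ L)) F
      ≡⟨ ∑-perms-∷ x L F ⟩
    ∑ (perms L) (λ σ → ∑ (insertions x σ) F)
      ≡⟨ ∑-perms-shuffles L _ ⟩
    ∑ (perms L₁) (λ α → ∑ (perms L₂) (λ β → ∑ (shuffles α β) (λ σ → ∑ (insertions x σ) F)))
      ≡⟨ ∑-cong (perms L₁) (λ {α} _ → ∑-cong (perms L₂) (λ {β} _ → ∑-shuffles-insertionsˡ x α β F)) ⟩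
    ∑ (perms L₁) (λ α → ∑ (perms L₂) (λ β → ∑ (insertions x α) (λ α′ → ∑ (shuffles α′ β) F)))
      ≡⟨ ∑-cong (perms L₁) (λ {α} _ → ∑-comm (perms L₂) (insertions x α) _) ⟩
    ∑ (perms L₁) (λ α → ∑ (insertions x α) (λ α′ → ∑ (perms L₂) (λ β → ∑ (shuffles α′ β) F)))
      ≡⟨ ∑-perms-∷ x L₁ _ ⟨
    ∑ (perms (x ∷ L₁)) (λ α → ∑ (perms L₂) (λ β → ∑ (shuffles α β) F)) ∎
    where
    open ≡-Reasoning
    L₁ = filter P? L
    L₂ = filter (∁? P?) L
  ... | no _ = begin
    ∑ (perms (x ∷ L)) F
      ≡⟨ ∑-perms-∷ x L F ⟩
    ∑ (perms L) (λ σ → ∑ (insertions x σ) F)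
      ≡⟨ ∑-perms-shuffles L _ ⟩
    ∑ (perms L₁) (λ α → ∑ (perms L₂) (λ β → ∑ (shuffles α β) (λ σ → ∑ (insertions x σ) F)))
      ≡⟨ ∑-cong (perms L₁) (λ {α} _ → ∑-cong (perms L₂) (λ {β} _ → ∑-shuffles-insertionsʳ x α β F)) ⟩
    ∑ (perms L₁) (λ α → ∑ (perms L₂) (λ β → ∑ (insertions x β) (λ β′ → ∑ (shuffles α β′) F)))
      ≡⟨ ∑-cong (perms L₁) (λ _ → ∑-perms-∷ x L₂ _) ⟨
    ∑ (perms L₁) (λ α → ∑ (perms (x ∷ L₂)) (λ β → ∑ (shuffles α β) F)) ∎
    where
    open ≡-Reasoning
    L₁ = filter P? L
    L₂ = filter (∁? P?) L

  -- Every shuffle of a permutation of the P-elements with one of the others has the same two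
  -- filtrations, and there are equally many such shuffles for every such pair.
  ∑-perms-factorise : (L : List A) (f g : List A → ℕ) →
                      ∑ (perms L) (λ σ → f (filter P? σ) * g (filter (∁? P?) σ))
                      ≡ shuffleCount (length (filter P? L)) (length (filter (∁? P?) L))
                        * (∑ (perms (filter P? L)) f * ∑ (perms (filter (∁? P?) L)) g)
  ∑-perms-factorise L f g = begin
    ∑ (perms L) H
      ≡⟨ ∑-perms-shuffles L H ⟩
    ∑ (perms L₁) (λ α → ∑ (perms L₂) (λ β → ∑ (shuffles α β) H))
      ≡⟨ ∑-cong (perms L₁) (λ α∈ → ∑-cong (perms L₂) (λ β∈ → ∑-shuffles α∈ β∈)) ⟩
    ∑ (perms L₁) (λ α → ∑ (perms L₂) (λ β → C * (f α * g β)))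
      ≡⟨ ∑-cong (perms L₁) (λ {α} _ → trans (∑-*ˡ C (perms L₂)) (cong (C *_) (∑-*ˡ (f α) (perms L₂)))) ⟩
    ∑ (perms L₁) (λ α → C * (f α * ∑ (perms L₂) g))
      ≡⟨ trans (∑-*ˡ C (perms L₁)) (cong (C *_) (∑-*ʳ (∑ (perms L₂) g) (perms L₁))) ⟩
    C * (∑ (perms L₁) f * ∑ (perms L₂) g) ∎
    where
    open ≡-Reasoning
    L₁ = filter P? L
    L₂ = filter (∁? P?) L
    C = shuffleCount (length L₁) (length L₂)
    H : List A → ℕ
    H σ = f (filter P? σ) * g (filter (∁? P?) σ)
    ∑-shuffles : {α β : List A} → α ∈ perms L₁ → β ∈ perms L₂ → ∑ (shuffles α β) H ≡ C * (f α * g β)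
    ∑-shuffles {α} {β} α∈ β∈ =
      trans (∑-const (shuffles α β) (f α * g β) (λ σ∈ → cong₂ _*_ (cong f (filter-α σ∈)) (cong g (filter-β σ∈))))
            (cong (_* (f α * g β))
                  (trans (length-shuffles α β) (cong₂ shuffleCount (↭-length (perms-↭ {L = L₁} α∈))
                                                                   (↭-length (perms-↭ {L = L₂} β∈)))))
      where
      Pα : All P α
      Pα = All-resp-↭ (↭.↭-sym (perms-↭ {L = L₁} α∈)) (all-filter P? L)
      ¬Pβ : All (∁ P) β
      ¬Pβ = All-resp-↭ (↭.↭-sym (perms-↭ {L = L₂} β∈)) (all-filter (∁? P?) L)
      filter-α : ∀ {σ} → σ ∈ shuffles α β → filter P? σ ≡ α
      filter-α σ∈ = trans (filter-shuffles-rejectʳ P? α β ¬Pβ σ∈) (filter-all P? Pα)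
      filter-β : ∀ {σ} → σ ∈ shuffles α β → filter (∁? P?) σ ≡ β
      filter-β σ∈ = trans (filter-shuffles-rejectˡ (∁? P?) α β (All.map (λ Pa ¬Pa → ¬Pa Pa) Pα) σ∈)
                          (filter-all (∁? P?) ¬Pβ)

  length-perms-factorise : (L : List A) →
                           length (perms L)
                           ≡ shuffleCount (length (filter P? L)) (length (filter (∁? P?) L))
                             * (length (perms (filter P? L)) * length (perms (filter (∁? P?) L)))
  length-perms-factorise L =
    trans (sym (∑-1 (perms L)))
          (trans (∑-perms-factorise L (λ _ → 1) (λ _ → 1))
                 (cong (shuffleCount (length L₁) (length L₂) *_)
                       (cong₂ _*_ (∑-1 (perms L₁)) (∑-1 (perms L₂)))))
    where
    L₁ = filter P? L
    L₂ = filter (∁? P?) L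

PairwiseDisjoint : {t : ℕ} → (Fin t → Pred A 0ℓ) → Set
PairwiseDisjoint P = ∀ i j → i ≢ j → ∀ {x} → P i x → ¬ P j x

-- The filtrations of a uniformly random ordering along pairwise disjoint predicates are independent
-- and uniformly distributed; stated with the denominators cleared.
perms-filters-independent :
  (t : ℕ) {P : Fin t → Pred A 0ℓ} (P? : ∀ i → Decidable (P i)) → PairwiseDisjoint P →
  (h : Fin t → List A → ℕ) (L : List A) →
  ∑ (perms L) (λ σ → prodFin t (λ i → h i (filter (P? i) σ)))
    * prodFin t (λ i → length (perms (filter (P? i) L)))
  ≡ prodFin t (λ i → ∑ (perms (filter (P? i) L)) (h i)) * length (perms L)
perms-filters-independent zero P? _ h L = trans (*-identityʳ _) (trans (∑-1 (perms L)) (sym (+-identityʳ _)))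
perms-filters-independent (suc t) P? disjoint h L = begin
  ∑ (perms L) (λ σ → h zero (filter q σ) * G σ) * (P₀ * Ps)
    ≡⟨ cong (_* (P₀ * Ps)) (trans (∑-cong (perms L) (λ {σ} _ → cong (h zero (filter q σ) *_) (G-∁q σ)))
                                  (∑-perms-factorise q L (h zero) G)) ⟩
  C * (S₀ * ∑ (perms L₂) G) * (P₀ * Ps)
    ≡⟨ rearrange C S₀ _ P₀ Ps Ss Q IH ⟩
  S₀ * Ss * (C * (P₀ * Q))
    ≡⟨ cong (S₀ * Ss *_) (length-perms-factorise q L) ⟨
  S₀ * Ss * length (perms L) ∎
  where
  open ≡-Reasoning
  q = P? zero
  L₂ = filter (∁? q) L
  G : List _ → ℕ
  G σ = prodFin t (λ i → h (suc i) (filter (P? (suc i)) σ))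
  filter-∁q : ∀ i σ → filter (P? (suc i)) (filter (∁? q) σ) ≡ filter (P? (suc i)) σ
  filter-∁q i = filter-filter-∁ (P? (suc i)) q (disjoint (suc i) zero (λ ()))
  G-∁q : ∀ σ → G σ ≡ G (filter (∁? q) σ)
  G-∁q σ = prodFin-cong t (λ i → cong (h (suc i)) (sym (filter-∁q i σ)))
  C = shuffleCount (length (filter q L)) (length L₂)
  S₀ = ∑ (perms (filter q L)) (h zero)
  P₀ = length (perms (filter q L))
  Q = length (perms L₂)
  Ps = prodFin t (λ i → length (perms (filter (P? (suc i)) L)))
  Ss = prodFin t (λ i → ∑ (perms (filter (P? (suc i)) L)) (h (suc i)))
  IH : ∑ (perms L₂) G * Ps ≡ Ss * Q
  IH = subst₂ (λ ps ss → ∑ (perms L₂) G * ps ≡ ss * Q)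
         (prodFin-cong t (λ i → cong (length ∘ perms) (filter-∁q i L)))
         (prodFin-cong t (λ i → cong (λ M → ∑ (perms M) (h (suc i))) (filter-∁q i L)))
         (perms-filters-independent t (P? ∘ suc) (λ i j i≢j → disjoint (suc i) (suc j) (i≢j ∘ suc-injective))
                                    (h ∘ suc) L₂)
  rearrange : ∀ c s₀ x p₀ ps ss q → x * ps ≡ ss * q → c * (s₀ * x) * (p₀ * ps) ≡ s₀ * ss * (c * (p₀ * q))
  rearrange c s₀ x p₀ ps ss q eq = begin
    c * (s₀ * x) * (p₀ * ps) ≡⟨ lhs c s₀ x p₀ ps ⟩
    c * s₀ * p₀ * (x * ps)   ≡⟨ cong (c * s₀ * p₀ *_) eq ⟩
    c * s₀ * p₀ * (ss * q)   ≡⟨ rhs c s₀ p₀ ss q ⟩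
    s₀ * ss * (c * (p₀ * q)) ∎
    where
    lhs : ∀ c s₀ x p₀ ps → c * (s₀ * x) * (p₀ * ps) ≡ c * s₀ * p₀ * (x * ps)
    lhs = solve-∀
    rhs : ∀ c s₀ p₀ ss q → c * s₀ * p₀ * (ss * q) ≡ s₀ * ss * (c * (p₀ * q))
    rhs = solve-∀

-- Balls and visible neighbourhoods

==⇒≡ : {n : ℕ} (a b : Fin n) → T (a == b) → a ≡ b
==⇒≡ a b = toWitness {a? = a Fin.≟ b}

==-refl : {n : ℕ} (a : Fin n) → T (a == a)
==-refl a = fromWitness {a? = a Fin.≟ a} refl

data Joins {n : ℕ} : Edge n → Fin n → Fin n → Set where
  forward : ∀ {u v} → Joins (u , v) u v
  backward : ∀ {u v} → Joins (u , v) v u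

module _ {n : ℕ} where

  inBall-endpoint : (r : ℕ) (Es : List (Edge n)) {e : Edge n} {w v : Fin n} →
                    Joins e w v → T (inBall r Es e w)
  inBall-endpoint zero Es {u , v} forward = Equivalence.from T-∨ (inj₁ (==-refl u))
  inBall-endpoint zero Es {u , v} backward = Equivalence.from T-∨ (inj₂ (==-refl v))
  inBall-endpoint (suc r) Es j = Equivalence.from T-∨ (inj₁ (inBall-endpoint r Es j))

  inBall-suc : (r : ℕ) {Es : List (Edge n)} {e : Edge n} {w : Fin n} →
               T (inBall r Es e w) → T (inBall (suc r) Es e w)
  inBall-suc r b = Equivalence.from T-∨ (inj₁ b)

  leadsInto : ℕ → List (Edge n) → Edge n → Fin n → Edge n → Bool
  leadsInto r Es e w x =
    ((proj₁ x == w) ∧ inBall r Es e (proj₂ x)) ∨ ((proj₂ x == w) ∧ inBall r Es e (proj₁ x))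

  leadsInto⁺ : (r : ℕ) {Es : List (Edge n)} {e x : Edge n} {w v : Fin n} →
               Joins x w v → T (inBall r Es e v) → T (leadsInto r Es e w x)
  leadsInto⁺ r {x = u , v} forward b = Equivalence.from T-∨ (inj₁ (Equivalence.from T-∧ (==-refl u , b)))
  leadsInto⁺ r {x = u , v} backward b = Equivalence.from T-∨ (inj₂ (Equivalence.from T-∧ (==-refl v , b)))

  leadsInto⁻ : (r : ℕ) {Es : List (Edge n)} {e : Edge n} (x : Edge n) {w : Fin n} →
               T (leadsInto r Es e w x) → ∃[ v ] Joins x w v × T (inBall r Es e v)
  leadsInto⁻ r (u , v) {w} l with Equivalence.to T-∨ l
  ... | inj₁ l₁ with Equivalence.to T-∧ l₁
  ...   | u=w , b with ==⇒≡ u w u=w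
  ...     | refl = v , forward , b
  leadsInto⁻ r (u , v) {w} l | inj₂ l₂ with Equivalence.to T-∧ l₂
  ...   | v=w , b with ==⇒≡ v w v=w
  ...     | refl = u , backward , b

  inBall-step : (r : ℕ) {Es : List (Edge n)} {e x : Edge n} {w v : Fin n} →
                x ∈ Es → Joins x w v → T (inBall r Es e v) → T (inBall (suc r) Es e w)
  inBall-step r {Es} {e} {w = w} x∈ j b =
    Equivalence.from T-∨ (inj₂ (any⁺ (leadsInto r Es e w) (Any.map (λ { refl → leadsInto⁺ r j b }) x∈)))

  inBall-suc⁻ : (r : ℕ) {Es : List (Edge n)} {e : Edge n} {w : Fin n} → T (inBall (suc r) Es e w) →
                T (inBall r Es e w) ⊎ ∃[ x ] ∃[ v ] x ∈ Es × Joins x w v × T (inBall r Es e v)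
  inBall-suc⁻ r {Es} {e} {w} b with Equivalence.to T-∨ b
  ... | inj₁ b′ = inj₁ b′
  ... | inj₂ l with find (any⁻ (leadsInto r Es e w) Es l)
  ...   | x , x∈ , lx with leadsInto⁻ r x lx
  ...     | v , j , bv = inj₂ (x , v , x∈ , j , bv)

  inBall-mono : (r : ℕ) {Es Es′ : List (Edge n)} {e : Edge n} → Es ⊆ Es′ →
                {w : Fin n} → T (inBall r Es e w) → T (inBall r Es′ e w)
  inBall-mono zero _ b = b
  inBall-mono (suc r) Es⊆ b with inBall-suc⁻ r b
  ... | inj₁ b′ = inBall-suc r (inBall-mono r Es⊆ b′)
  ... | inj₂ (x , v , x∈ , j , bv) = inBall-step r (Es⊆ x∈) j (inBall-mono r Es⊆ bv)

  inBall-resp-↭ : (r : ℕ) {Es Es′ : List (Edge n)} → Es ↭ Es′ → (e : Edge n) (w : Fin n) →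
                  inBall r Es e w ≡ inBall r Es′ e w
  inBall-resp-↭ r p e w = T-extensional (inBall-mono r (∈-resp-↭ p)) (inBall-mono r (∈-resp-↭ (↭.↭-sym p)))

  inBall-∷-root : (r : ℕ) (Es : List (Edge n)) (e : Edge n) (w : Fin n) →
                  inBall r (e ∷ Es) e w ≡ inBall r Es e w
  inBall-∷-root r Es e w = T-extensional (drop-root r) (inBall-mono r (xs⊆x∷xs Es e))
    where
    drop-root : ∀ r {w} → T (inBall r (e ∷ Es) e w) → T (inBall r Es e w)
    drop-root zero b = b
    drop-root (suc r) b with inBall-suc⁻ r b
    ... | inj₁ b′ = inBall-suc r (drop-root r b′)
    ... | inj₂ (x , v , here refl , j , _) = inBall-endpoint (suc r) Es j
    ... | inj₂ (x , v , there x∈ , j , bv) = inBall-step r x∈ j (drop-root r bv)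

  touches-resp-↭ : (ℓ : ℕ) (e : Edge n) {acc acc′ : List (Edge n)} → acc ↭ acc′ → (x : Edge n) →
                   touches ℓ e acc x ≡ touches ℓ e acc′ x
  touches-resp-↭ zero e p x = refl
  touches-resp-↭ (suc r) e p x = cong₂ _∨_ (inBall-resp-↭ r p e (proj₁ x)) (inBall-resp-↭ r p e (proj₂ x))

  touches-∷-root : (ℓ : ℕ) (e : Edge n) (acc : List (Edge n)) (x : Edge n) →
                   touches ℓ e (e ∷ acc) x ≡ touches ℓ e acc x
  touches-∷-root zero e acc x = refl
  touches-∷-root (suc r) e acc x =
    cong₂ _∨_ (inBall-∷-root r acc e (proj₁ x)) (inBall-∷-root r acc e (proj₂ x))

  touches-root : (r : ℕ) (e : Edge n) (acc : List (Edge n)) → T (touches (suc r) e acc e)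
  touches-root r (u , v) acc = Equivalence.from T-∨ (inj₁ (inBall-endpoint r acc forward))

  inNbhd : ℕ → List (Edge n) → Edge n → Edge n → Bool
  inNbhd ℓ Es e x = inBall ℓ Es e (proj₁ x) ∧ inBall ℓ Es e (proj₂ x)

  touches⇒inNbhd : (ℓ : ℕ) {E acc : List (Edge n)} (e : Edge n) {x : Edge n} → acc ⊆ E → x ∈ E →
                   T (touches ℓ e acc x) → T (inNbhd ℓ E e x)
  touches⇒inNbhd (suc r) e {u , v} acc⊆ x∈ t with Equivalence.to T-∨ t
  ... | inj₁ bu = let bu′ = inBall-mono r acc⊆ bu in
                  Equivalence.from T-∧ (inBall-suc r bu′ , inBall-step r x∈ backward bu′)
  ... | inj₂ bv = let bv′ = inBall-mono r acc⊆ bv in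
                  Equivalence.from T-∧ (inBall-step r x∈ forward bv′ , inBall-suc r bv′)

  visEdgesGo-resp-↭ : (ℓ : ℕ) (e : Edge n) {acc acc′ : List (Edge n)} → acc ↭ acc′ → (σ : List (Edge n)) →
                      visEdgesGo ℓ e acc σ ↭ visEdgesGo ℓ e acc′ σ
  visEdgesGo-resp-↭ ℓ e p [] = p
  visEdgesGo-resp-↭ ℓ e {acc} {acc′} p (x ∷ σ) rewrite touches-resp-↭ ℓ e p x with touches ℓ e acc′ x
  ... | true = visEdgesGo-resp-↭ ℓ e (prep x p) σ
  ... | false = visEdgesGo-resp-↭ ℓ e p σ

  visEdgesGo-∷-root : (r : ℕ) (e : Edge n) (acc σ : List (Edge n)) →
                      visEdgesGo (suc r) e (e ∷ acc) σ ↭ e ∷ visEdgesGo (suc r) e acc σ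
  visEdgesGo-∷-root r e acc [] = ↭.refl
  visEdgesGo-∷-root r e acc (x ∷ σ) rewrite touches-∷-root (suc r) e acc x with touches (suc r) e acc x
  ... | true = ↭.trans (visEdgesGo-resp-↭ (suc r) e (swap x e ↭.refl) σ) (visEdgesGo-∷-root r e (x ∷ acc) σ)
  ... | false = visEdgesGo-∷-root r e acc σ

  visEdgesGo-root-first : (r : ℕ) (e : Edge n) (acc σ : List (Edge n)) →
                          visEdgesGo (suc r) e acc (e ∷ σ) ↭ e ∷ visEdgesGo (suc r) e acc σ
  visEdgesGo-root-first r e acc σ with touches (suc r) e acc e | touches-root r e acc
  ... | true | _ = visEdgesGo-∷-root r e acc σ

  visEdgesGo-zero : (e : Edge n) (acc σ : List (Edge n)) → visEdgesGo zero e acc σ ≡ acc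
  visEdgesGo-zero e acc [] = refl
  visEdgesGo-zero e acc (x ∷ σ) = visEdgesGo-zero e acc σ

  visEdgesGo-insertions : (ℓ : ℕ) (e : Edge n) (acc γ : List (Edge n)) {π : List (Edge n)} →
                          π ∈ insertions e γ → visEdgesGo ℓ e acc π ↭ visEdgesGo ℓ e acc (e ∷ γ)
  visEdgesGo-insertions zero e acc γ {π} _ =
    ↭.↭-reflexive (trans (visEdgesGo-zero e acc π) (sym (visEdgesGo-zero e acc (e ∷ γ))))
  visEdgesGo-insertions (suc r) e acc [] (here refl) = ↭.refl
  visEdgesGo-insertions (suc r) e acc (y ∷ γ) (here refl) = ↭.refl
  visEdgesGo-insertions (suc r) e acc (y ∷ γ) (there π∈) with ∈-map⁻ (y ∷_) π∈
  ... | π , π∈′ , refl = begin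
    visEdgesGo (suc r) e acc′ π        ↭⟨ visEdgesGo-insertions (suc r) e acc′ γ π∈′ ⟩
    visEdgesGo (suc r) e acc′ (e ∷ γ)  ↭⟨ visEdgesGo-root-first r e acc′ γ ⟩
    e ∷ visEdgesGo (suc r) e acc′ γ    ↭⟨ visEdgesGo-root-first r e acc (y ∷ γ) ⟨
    visEdgesGo (suc r) e acc (e ∷ y ∷ γ) ∎
    where
    open ↭.PermutationReasoning
    acc′ = if touches (suc r) e acc y then y ∷ acc else acc

  module _ {P : Pred (Edge n) 0ℓ} (P? : Decidable P) (ℓ : ℕ) (e : Edge n) {E : List (Edge n)}
           (touched⇒P : ∀ {acc x} → acc ⊆ E → x ∈ E → T (touches ℓ e acc x) → P x) where

    visEdgesGo-filter : (acc σ : List (Edge n)) → acc ⊆ E → σ ⊆ E →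
                        visEdgesGo ℓ e acc σ ≡ visEdgesGo ℓ e acc (filter P? σ)
    visEdgesGo-filter acc [] _ _ = refl
    visEdgesGo-filter acc (x ∷ σ) acc⊆ σ⊆ with P? x
    ... | yes _ with touches ℓ e acc x
    ...   | true = visEdgesGo-filter (x ∷ acc) σ (∈-∷⁺ʳ (σ⊆ (here refl)) acc⊆) (σ⊆ ∘ there)
    ...   | false = visEdgesGo-filter acc σ acc⊆ (σ⊆ ∘ there)
    visEdgesGo-filter acc (x ∷ σ) acc⊆ σ⊆ | no ¬Px with touches ℓ e acc x in touched
    ...   | true = ⊥-elim (¬Px (touched⇒P acc⊆ (σ⊆ (here refl)) (Equivalence.from T-≡ touched)))
    ...   | false = visEdgesGo-filter acc σ acc⊆ (σ⊆ ∘ there)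

visEdges-restrict : {n : ℕ} (ℓ : ℕ) {E : List (Edge n)} (e : Edge n) {σ : List (Edge n)} → σ ⊆ E →
                    visEdges ℓ e σ ≡ visEdges ℓ e (filter (T? ∘ inNbhd ℓ E e) σ)
visEdges-restrict ℓ e σ⊆ =
  visEdgesGo-filter (T? ∘ inNbhd ℓ _ e) ℓ e (touches⇒inNbhd ℓ e) [] _ (λ ()) σ⊆

module _ {k n : ℕ} (χ : Fin n → Fin k) (e : Edge n) where

  rootedOn : (Fin n → Bool) → List (Edge n) → RGraph k
  rootedOn V Es = record { N = n ; inV = V ; edges = Es ; col = χ ; root = e }

  sameType-cong : {V V′ : Fin n → Bool} {Es Es′ : List (Edge n)} → (∀ a → V a ≡ V′ a) →
                  (∀ a b → mult (a , b) Es ≡ mult (a , b) Es′) → (R : RGraph k) →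
                  sameType (rootedOn V Es) R ≡ sameType (rootedOn V′ Es′) R
  sameType-cong {V} {V′} {Es} {Es′} V≗V′ mult≗ R =
    cong or (map-cong (λ f → cong or (map-cong (isIsoPair-cong f) (allFuns (N R) n))) (allFuns n (N R)))
    where
    isIsoPair-cong : ∀ f g → isIsoPair (rootedOn V Es) R f g ≡ isIsoPair (rootedOn V′ Es′) R f g
    isIsoPair-cong f g = cong₂ _∧_
      (cong and (map-cong (λ a → cong₂ _∨_ (cong not (V≗V′ a))
        (cong (λ z → inV R (f a) ∧ (g (f a) == a) ∧ (χ a == col R (f a)) ∧ z)
          (cong and (map-cong (λ b → cong₂ _∨_ (cong not (V≗V′ b))
            (cong (λ m → ⌊ m ℕ.≟ mult (f a , f b) (edges R) ⌋) (mult≗ a b))) (allFin n)))))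
        (allFin n)))
      (cong (_∧ _) (cong and (map-cong (λ c → cong (λ z → not (inV R c) ∨ (z ∧ (f (g c) == c))) (V≗V′ (g c)))
                                       (allFin (N R)))))

visGraph-resp-↭ : {k n : ℕ} (χ : Fin n → Fin k) (ℓ : ℕ) (e : Edge n) {σ σ′ : List (Edge n)} →
                  visEdges ℓ e σ ↭ visEdges ℓ e σ′ → (R : RGraph k) →
                  sameType (visGraph χ ℓ e σ) R ≡ sameType (visGraph χ ℓ e σ′) R
visGraph-resp-↭ χ ℓ (u , v) {σ} {σ′} p =
  sameType-cong χ (u , v) {Es = visEdges ℓ (u , v) σ} {Es′ = visEdges ℓ (u , v) σ′}
                (λ w → cong (λ z → (w == u) ∨ (w == v) ∨ z) (any-resp-↭ _ p))
                (λ a b → countBy-resp-↭ (edgeEq (a , b)) p)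

edgeEq-refl : {n : ℕ} (x : Edge n) → T (edgeEq x x)
edgeEq-refl (a , b) = Equivalence.from T-∧ (==-refl a , ==-refl b)

edgeEq⇒≡ : {n : ℕ} (x y : Edge n) → T (edgeEq x y) → x ≡ y
edgeEq⇒≡ (a , b) (c , d) t with Equivalence.to T-∧ t
... | a=c , b=d = cong₂ _,_ (==⇒≡ a c a=c) (==⇒≡ b d b=d)

removeOne-↭ : {n : ℕ} {x : Edge n} {Es : List (Edge n)} → x ∈ Es → Es ↭ x ∷ removeOne x Es
removeOne-↭ {x = x} {y ∷ ys} x∈ with edgeEq x y in x=y | x∈
... | true | _ = ↭.↭-reflexive (cong (_∷ ys) (sym (edgeEq⇒≡ x y (Equivalence.from T-≡ x=y))))
... | false | here refl with () ← trans (sym x=y) (Equivalence.to T-≡ (edgeEq-refl x))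
... | false | there x∈ys = ↭.trans (prep y (removeOne-↭ x∈ys)) (swap y x ↭.refl)

removeAll-↭ : {n : ℕ} (xs Es : List (Edge n)) → Unique xs → xs ⊆ Es → Es ↭ xs ++ removeAll xs Es
removeAll-↭ [] Es _ _ = ↭.refl
removeAll-↭ (x ∷ xs) Es (x∉xs ∷ unique) xs⊆ = begin
  Es                                      ↭⟨ Es↭ ⟩
  xs ++ removeAll xs Es                   ↭⟨ ++⁺ˡ xs (removeOne-↭ x∈rest) ⟩
  xs ++ x ∷ removeOne x (removeAll xs Es) ↭⟨ shift x xs _ ⟩
  x ∷ xs ++ removeAll (x ∷ xs) Es         ∎
  where
  open ↭.PermutationReasoning
  Es↭ = removeAll-↭ xs Es unique (xs⊆ ∘ there)
  x∈rest : x ∈ removeAll xs Es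
  x∈rest with ∈-++⁻ xs (∈-resp-↭ Es↭ (xs⊆ (here refl)))
  ... | inj₁ x∈xs = ⊥-elim (All¬⇒¬Any x∉xs x∈xs)
  ... | inj₂ x∈rest = x∈rest

module DisjointNeighbourhoods {k n t : ℕ} (χ : Fin n → Fin k) (ℓ : ℕ) (E : List (Edge n))
         (τ : Vec (Edge n) t) (τ⊆E : ∀ i → lookup τ i ∈ E) (disjoint : DisjointBalls ℓ E τ) where

  e : Fin t → Edge n
  e = lookup τ

  Nbhd : Fin t → Pred (Edge n) 0ℓ
  Nbhd i x = T (inNbhd ℓ E (e i) x)

  nbhd? : ∀ i → Decidable (Nbhd i)
  nbhd? i = T? ∘ inNbhd ℓ E (e i)

  rest : List (Edge n)
  rest = removeAll (toList τ) E

  M : Fin t → List (Edge n)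
  M i = filter (nbhd? i) rest

  visibleIndicator : Fin t → RGraph k → List (Edge n) → ℕ
  visibleIndicator i Rᵢ γ = 𝟙 (sameType (visGraph χ ℓ (e i) (e i ∷ γ)) Rᵢ)

  root-in-nbhd : ∀ i → Nbhd i (e i)
  root-in-nbhd i = Equivalence.from T-∧ (inBall-endpoint ℓ E forward , inBall-endpoint ℓ E backward)

  nbhds-disjoint : PairwiseDisjoint Nbhd
  nbhds-disjoint i j i≢j x∈Nᵢ x∈Nⱼ =
    subst T (disjoint i j i≢j _ (Equivalence.to T-≡ (proj₁ (Equivalence.to T-∧ x∈Nᵢ))))
            (proj₁ (Equivalence.to T-∧ x∈Nⱼ))

  roots-injective : ∀ {i j} → e i ≡ e j → i ≡ j
  roots-injective {i} {j} eᵢ≡eⱼ with i Fin.≟ j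
  ... | yes i≡j = i≡j
  ... | no i≢j =
    ⊥-elim (nbhds-disjoint i j i≢j (root-in-nbhd i) (subst (Nbhd j) (sym eᵢ≡eⱼ) (root-in-nbhd j)))

  τ-edges⊆E : toList τ ⊆ E
  τ-edges⊆E x∈τ with ∈-tabulate⁻ (subst (_ ∈_) (toList-tabulate τ) x∈τ)
  ... | i , refl = τ⊆E i

  E↭τ++rest : E ↭ toList τ ++ rest
  E↭τ++rest = removeAll-↭ (toList τ) E (subst Unique (sym (toList-tabulate τ)) (Unique.tabulate⁺ roots-injective))
                          τ-edges⊆E

  filter-nbhd-τ : ∀ i → filter (nbhd? i) (toList τ) ≡ e i ∷ []
  filter-nbhd-τ i = trans (cong (filter (nbhd? i)) (toList-tabulate τ))
                     (filter-tabulate-single (nbhd? i) e i (root-in-nbhd i)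
                                             (λ j j≢i → nbhds-disjoint j i j≢i (root-in-nbhd j)))

  nbhdEdges↭ : ∀ i → nbhdEdges ℓ E (e i) ↭ e i ∷ M i
  nbhdEdges↭ i = subst (nbhdEdges ℓ E (e i) ↭_)
                       (trans (filter-++ (nbhd? i) (toList τ) rest) (cong (_++ M i) (filter-nbhd-τ i)))
                       (filter-↭ (nbhd? i) E↭τ++rest)

  visEdges-after-τ : ∀ i {σ} → σ ⊆ E →
                     visEdges ℓ (e i) (toList τ ++ σ) ≡ visEdges ℓ (e i) (e i ∷ filter (nbhd? i) σ)
  visEdges-after-τ i {σ} σ⊆E =
    trans (visEdges-restrict ℓ (e i) ([ τ-edges⊆E , σ⊆E ]′ ∘ ∈-++⁻ (toList τ)))
          (cong (visEdges ℓ (e i))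
                (trans (filter-++ (nbhd? i) (toList τ) σ) (cong (_++ filter (nbhd? i) σ) (filter-nbhd-τ i))))

  count₁-as-∑ : (R : Fin t → RGraph k) →
                count₁ χ ℓ E τ R
                ≡ ∑ (perms rest) (λ σ → prodFin t (λ i → visibleIndicator i (R i) (filter (nbhd? i) σ)))
  count₁-as-∑ R = trans (countBy-∑ _ (perms rest)) (∑-cong (perms rest) (λ {σ} σ∈ →
    trans (𝟙-all-tabulate t _ (λ i → i))
          (prodFin-cong t (λ i → cong (λ Es → 𝟙 (sameType (rootedOn χ (e i) (visVerts (e i) Es) Es) (R i)))
                                      (visEdges-after-τ i (rest⊆E ∘ ∈-resp-↭ (perms-↭ {L = rest} σ∈)))))))
    where
    rest⊆E : rest ⊆ E
    rest⊆E = ∈-resp-↭ (↭.↭-sym E↭τ++rest) ∘ ∈-++⁺ʳ (toList τ)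

  count₂-as-∑ : ∀ i (Rᵢ : RGraph k) →
                count₂ χ ℓ E (e i) Rᵢ ≡ suc (length (M i)) * ∑ (perms (M i)) (visibleIndicator i Rᵢ)
  count₂-as-∑ i Rᵢ =
    trans (countBy-∑ _ (perms (nbhdEdges ℓ E (e i))))
          (∑-perms-insertions-invariant (nbhdEdges↭ i) _ (visibleIndicator i Rᵢ) (λ γ {π} π∈ →
            cong 𝟙 (visGraph-resp-↭ χ ℓ (e i) {π} {e i ∷ γ} (visEdgesGo-insertions ℓ (e i) [] γ π∈) Rᵢ)))

  total₂-as-∑ : ∀ i → total₂ ℓ E (e i) ≡ suc (length (M i)) * length (perms (M i))
  total₂-as-∑ i =
    trans (sym (∑-1 (perms (nbhdEdges ℓ E (e i)))))
          (trans (∑-perms-insertions-invariant (nbhdEdges↭ i) _ (λ _ → 1) (λ _ _ → refl))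
                 (cong (suc (length (M i)) *_) (∑-1 (perms (M i)))))

*-rescale : ∀ a p s b c → a * p ≡ s * b → a * (c * p) ≡ c * s * b
*-rescale a p s b c eq = begin
  a * (c * p) ≡⟨ *-left-comm a c p ⟩
  c * (a * p) ≡⟨ cong (c *_) eq ⟩
  c * (s * b) ≡⟨ *-assoc c s b ⟨
  c * s * b   ∎
  where
  open ≡-Reasoning
  *-left-comm : ∀ x y z → x * (y * z) ≡ y * (x * z)
  *-left-comm = solve-∀

proposition6p8 : (k ℓ D n : ℕ) (E : List (Edge n)) (χ : Fin n → Fin k) →
    Loopless E → DBounded D E → ProperColoring χ E →
    (t : ℕ) (τ : Vec (Edge n) t) →
    ((i : Fin t) → lookup τ i ∈ E) →
    DisjointBalls ℓ E τ →
    (R : Fin t → RGraph k) →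
    count₁ χ ℓ E τ R * prodFin t (λ i → total₂ ℓ E (lookup τ i))
      ≡ prodFin t (λ i → count₂ χ ℓ E (lookup τ i) (R i)) * total₁ E τ
proposition6p8 k ℓ D n E χ _ _ _ t τ τ⊆E disjoint R = begin
  count₁ χ ℓ E τ R * prodFin t (λ i → total₂ ℓ E (e i))
    ≡⟨ cong₂ _*_ (count₁-as-∑ R) (trans (prodFin-cong t total₂-as-∑) (prodFin-* t C orderings)) ⟩
  jointly * (prodFin t C * prodFin t orderings)
    ≡⟨ *-rescale jointly (prodFin t orderings) (prodFin t separately) (total₁ E τ) (prodFin t C)
                 (perms-filters-independent t nbhd? nbhds-disjoint h rest) ⟩
  prodFin t C * prodFin t separately * total₁ E τ
    ≡⟨ cong (_* total₁ E τ) (trans (prodFin-cong t (λ i → count₂-as-∑ i (R i))) (prodFin-* t C separately)) ⟨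
  prodFin t (λ i → count₂ χ ℓ E (e i) (R i)) * total₁ E τ ∎
  where
  open DisjointNeighbourhoods χ ℓ E τ τ⊆E disjoint
  open ≡-Reasoning
  h : Fin t → List (Edge n) → ℕ
  h i = visibleIndicator i (R i)
  jointly : ℕ
  jointly = ∑ (perms rest) (λ σ → prodFin t (λ i → h i (filter (nbhd? i) σ)))
  C orderings separately : Fin t → ℕ
  C i = suc (length (M i))
  orderings i = length (perms (M i))
  separately i = ∑ (perms (M i)) (h i)
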